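{- Let $N\ge 0$ be an integer. For each $k=0,1,\dots,2N$ let $$F_{(2N-k)}(t)={}_1F_2\Bigl(1;\Bigl\lfloor\frac{k+2}{2}\Bigr\rfloor,\Bigl\lfloor\frac{k+1}{2}\Bigr\rfloor+\frac12;\frac{t^2}{4}\Bigr).$$ Then for each $k=0,1,\dots,2N$, $$\cosh t=\sum_{i=0}^k\frac{t^i}{i!}\binom{k}{i}\frac{d^i}{dt^i}F_{(2N-k)}(t).$$
   Context: ${}_1F_2(a;b,c;z)=\sum_{n\ge0}\frac{(a)^{(n)}}{(b)^{(n)}(c)^{(n)}}\frac{z^n}{n!}$ is the hypergeometric function, with rising factorial $(x)^{(n)}=x(x+1)\cdots(x+n-1)$, $(x)^{(0)}=1$. (For $k=2N$, $F_{(0)}={}_1F_2(1;N+1,\tfrac{2N+1}{2};\tfrac{t^2}{4})$.) -}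

module Defs where

open import Data.Nat using (ℕ; zero; suc; _≤?_; _∸_) renaming (_+_ to _+ℕ_; _*_ to _*ℕ_)
open import Data.Nat.Combinatorics using (_C_)
open import Data.Nat.Base using (_/_; _%_; ⌊_/2⌋)
open import Data.Integer using (+_)
open import Data.Rational using (ℚ; 0ℚ; 1ℚ; _+_; _*_; 1/_; ½; ≢-nonZero; _≟_) renaming (_/_ to _/ℚ_)
open import Relation.Nullary using (yes; no)
open import Relation.Binary.PropositionalEquality using (_≡_)

ℕ→ℚ : ℕ → ℚ
ℕ→ℚ n = + n /ℚ 1

-- Total inverse on ℚ (junk value 0 at 0; only ever applied to nonzero values below).
inv : ℚ → ℚ
inv q with q ≟ 0ℚ
... | yes _ = 0ℚ
... | no q≢0 = 1/_ q {{≢-nonZero q≢0}}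

rising : ℚ → ℕ → ℚ
rising x zero = 1ℚ
rising x (suc n) = rising x n * (x + ℕ→ℚ n)

factorial : ℕ → ℕ
factorial zero = 1
factorial (suc n) = suc n *ℕ factorial n

FPS : Set
FPS = ℕ → ℚ

_≈ₛ_ : FPS → FPS → Set
f ≈ₛ g = ∀ n → f n ≡ g n

hyp1F2 : ℚ → ℚ → ℚ → FPS
hyp1F2 a b c n = rising a n * inv (rising b n * rising c n * ℕ→ℚ (factorial n))

-- Substitution z := t²/4 : coefficient of t^m in f(t²/4).
substSqOver4 : FPS → FPS
substSqOver4 f m with m % 2
... | zero = f (m / 2) * inv (ℕ→ℚ (4 ^ℕ (m / 2)))
  where
  _^ℕ_ : ℕ → ℕ → ℕ
  x ^ℕ zero = 1
  x ^ℕ suc e = x *ℕ (x ^ℕ e)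
... | suc _ = 0ℚ

deriv : FPS → FPS
deriv f n = ℕ→ℚ (suc n) * f (suc n)

derivIter : ℕ → FPS → FPS
derivIter zero f = f
derivIter (suc i) f = deriv (derivIter i f)

mulT^ : ℕ → FPS → FPS
mulT^ i f n with i ≤? n
... | yes _ = f (n ∸ i)
... | no _ = 0ℚ

scale : ℚ → FPS → FPS
scale q f n = q * f n

_⊕_ : FPS → FPS → FPS
(f ⊕ g) n = f n + g n

sumTo : ℕ → (ℕ → FPS) → FPS
sumTo zero g = g 0
sumTo (suc k) g = sumTo k g ⊕ g (suc k)

coshS : FPS
coshS m with m % 2
... | zero = inv (ℕ→ℚ (factorial m))
... | suc _ = 0ℚ

-- F_{(2N-k)}(t) = 1F2(1; ⌊(k+2)/2⌋, ⌊(k+1)/2⌋ + 1/2; t²/4).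
F : ℕ → FPS
F k = substSqOver4 (hyp1F2 1ℚ (ℕ→ℚ ((k +ℕ 2) / 2)) (ℕ→ℚ ((k +ℕ 1) / 2) + ½))

rhs : ℕ → FPS
rhs k = sumTo k (λ i → scale (inv (ℕ→ℚ (factorial i)) * ℕ→ℚ (k C i)) (mulT^ i (derivIter i (F k))))

{-# OPTIONS --safe #-}
-- Compare coefficients of t^n. The t^(n-i) coefficient of the i-th derivative of F is
-- n!/(n-i)! F_n, so the i-th summand contributes C(k,i) C(n,i) F_n and, by Vandermonde's
-- identity, the right-hand side has coefficient C(n+k,k) F_n. The odd coefficients of F
-- vanish, and because its parameters b, c satisfy 4(b+j)(c+j) = (k+2j+2)(k+2j+1), the even
-- ones are F_2m = k!/(2m+k)!. Hence C(2m+k,k) F_2m = 1/(2m)!, the coefficient of cosh.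
module Submission where

open import Defs

import Data.Integer as ℤ
import Data.Integer.Properties as ℤₚ
open import Data.Nat as ℕ using (ℕ; zero; suc; _≤_; _≤?_; _∸_; _%_; _/_; _^_; _!)
open import Data.Nat.Combinatorics using (_C_; nCk≡n!/k![n-k]!; k![n∸k]!∣n!; k>n⇒nCk≡0; nCk+nC[k+1]≡[n+1]C[k+1])
open import Data.Nat.DivMod using (m*n/n≡m; m*n%n≡0; [m+kn]%n≡m%n; m*[n/m]≡n; +-distrib-/-∣ʳ)
import Data.Nat.Coprimality as Coprimality
import Data.Nat.Properties as ℕₚ
open import Algebra.Properties.CommutativeSemigroup ℕₚ.+-commutativeSemigroup
  using () renaming (interchange to +-interchange; x∙yz≈y∙xz to x+[y+z]≡y+[x+z])
import Data.Nat.Tactic.RingSolver as ℕ-Tactic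
open import Data.Nat.Divisibility using (divides-refl)
open import Data.List using (_∷_; [])
open import Data.Rational as ℚ using (ℚ; 0ℚ; 1ℚ; ½; _+_; _*_; _≟_; mkℚ; ≢-nonZero)
import Data.Rational.Properties as ℚₚ
open import Data.Rational.Solver using (module +-*-Solver)
import Data.Rational.Unnormalised as ℚᵘ
import Data.Rational.Unnormalised.Properties as ℚᵘₚ
open import Function using (_∘_)
open import Relation.Binary.PropositionalEquality
open import Relation.Nullary using (Dec; yes; no; contradiction)

ℕ→ℚ≡mkℚ : ∀ n → ℕ→ℚ n ≡ mkℚ (ℤ.+ n) 0 (Coprimality.sym (Coprimality.1-coprimeTo n))
ℕ→ℚ≡mkℚ n = ℚₚ.normalize-coprime _

ℕ→ℚ-injective : ∀ {m n} → ℕ→ℚ m ≡ ℕ→ℚ n → m ≡ n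
ℕ→ℚ-injective {m} {n} eq =
  ℤₚ.+-injective (cong ℚ.numerator (trans (sym (ℕ→ℚ≡mkℚ m)) (trans eq (ℕ→ℚ≡mkℚ n))))

ℕ→ℚ-suc : ∀ n → ℕ→ℚ (suc n) ≡ 1ℚ + ℕ→ℚ n
ℕ→ℚ-suc n = ℚₚ.toℚᵘ-injective (begin
  ℚ.toℚᵘ (ℕ→ℚ (suc n))               ≡⟨ cong ℚ.toℚᵘ (ℕ→ℚ≡mkℚ (suc n)) ⟩
  ℚᵘ.mkℚᵘ (ℤ.+ suc n) 0               ≈⟨ ℚᵘ.*≡* numerators ⟩
  ℚᵘ.1ℚᵘ ℚᵘ.+ ℚᵘ.mkℚᵘ (ℤ.+ n) 0       ≡⟨ cong (ℚᵘ.1ℚᵘ ℚᵘ.+_) (cong ℚ.toℚᵘ (ℕ→ℚ≡mkℚ n)) ⟨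
  ℚ.toℚᵘ 1ℚ ℚᵘ.+ ℚ.toℚᵘ (ℕ→ℚ n)      ≈⟨ ℚₚ.toℚᵘ-homo-+ 1ℚ (ℕ→ℚ n) ⟨
  ℚ.toℚᵘ (1ℚ + ℕ→ℚ n)                 ∎)
  where
  open ℚᵘₚ.≃-Reasoning
  numerators : ℤ.+ suc n ℤ.* ℤ.+ 1 ≡ (ℤ.+ 1 ℤ.* ℤ.+ 1 ℤ.+ ℤ.+ n ℤ.* ℤ.+ 1) ℤ.* ℤ.+ 1
  numerators = trans (ℤₚ.*-identityʳ _)
    (sym (trans (ℤₚ.*-identityʳ _) (cong (ℤ._+_ (ℤ.+ 1)) (ℤₚ.*-identityʳ (ℤ.+ n)))))

open ≡-Reasoning
open +-*-Solver

ℕ→ℚ-+ : ∀ m n → ℕ→ℚ (m ℕ.+ n) ≡ ℕ→ℚ m + ℕ→ℚ n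
ℕ→ℚ-+ zero    n = sym (ℚₚ.+-identityˡ (ℕ→ℚ n))
ℕ→ℚ-+ (suc m) n = begin
  ℕ→ℚ (suc (m ℕ.+ n))          ≡⟨ ℕ→ℚ-suc (m ℕ.+ n) ⟩
  1ℚ + ℕ→ℚ (m ℕ.+ n)           ≡⟨ cong (1ℚ +_) (ℕ→ℚ-+ m n) ⟩
  1ℚ + (ℕ→ℚ m + ℕ→ℚ n)         ≡⟨ ℚₚ.+-assoc 1ℚ (ℕ→ℚ m) (ℕ→ℚ n) ⟨
  1ℚ + ℕ→ℚ m + ℕ→ℚ n           ≡⟨ cong (_+ ℕ→ℚ n) (ℕ→ℚ-suc m) ⟨
  ℕ→ℚ (suc m) + ℕ→ℚ n          ∎

ℕ→ℚ-* : ∀ m n → ℕ→ℚ (m ℕ.* n) ≡ ℕ→ℚ m * ℕ→ℚ n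
ℕ→ℚ-* zero    n = sym (ℚₚ.*-zeroˡ (ℕ→ℚ n))
ℕ→ℚ-* (suc m) n = begin
  ℕ→ℚ (n ℕ.+ m ℕ.* n)          ≡⟨ ℕ→ℚ-+ n (m ℕ.* n) ⟩
  ℕ→ℚ n + ℕ→ℚ (m ℕ.* n)        ≡⟨ cong (ℕ→ℚ n +_) (ℕ→ℚ-* m n) ⟩
  ℕ→ℚ n + ℕ→ℚ m * ℕ→ℚ n        ≡⟨ solve 2 (λ a b → b :+ a :* b := (con 1ℚ :+ a) :* b) refl (ℕ→ℚ m) (ℕ→ℚ n) ⟩
  (1ℚ + ℕ→ℚ m) * ℕ→ℚ n         ≡⟨ cong (_* ℕ→ℚ n) (ℕ→ℚ-suc m) ⟨
  ℕ→ℚ (suc m) * ℕ→ℚ n          ∎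

ℕ→ℚ≢0 : ∀ {n} → n ≢ 0 → ℕ→ℚ n ≢ 0ℚ
ℕ→ℚ≢0 n≢0 = n≢0 ∘ ℕ→ℚ-injective

inv-inverseʳ : ∀ {q} → q ≢ 0ℚ → q * inv q ≡ 1ℚ
inv-inverseʳ {q} q≢0 with q ≟ 0ℚ
... | yes q≡0 = contradiction q≡0 q≢0
... | no q≢0′ = ℚₚ.*-inverseʳ q {{≢-nonZero q≢0′}}

inv-unique : ∀ q {x} → q * x ≡ 1ℚ → inv q ≡ x
inv-unique q {x} qx≡1 = begin
  inv q                ≡⟨ ℚₚ.*-identityʳ (inv q) ⟨
  inv q * 1ℚ           ≡⟨ cong (inv q *_) qx≡1 ⟨
  inv q * (q * x)      ≡⟨ solve 3 (λ i a b → i :* (a :* b) := (a :* i) :* b) refl (inv q) q x ⟩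
  (q * inv q) * x      ≡⟨ cong (_* x) (inv-inverseʳ q≢0) ⟩
  1ℚ * x               ≡⟨ ℚₚ.*-identityˡ x ⟩
  x                    ∎
  where
  q≢0 : q ≢ 0ℚ
  q≢0 refl = ℚₚ.1≢0 (trans (sym qx≡1) (ℚₚ.*-zeroˡ x))

inv-involutive : ∀ q → inv (inv q) ≡ q
inv-involutive q with q ≟ 0ℚ
... | yes refl = refl
... | no q≢0 = inv-unique (ℚ.1/_ q {{≢-nonZero q≢0}}) (ℚₚ.*-inverseˡ q {{≢-nonZero q≢0}})

-- Unconditional, thanks to the junk value inv 0ℚ = 0ℚ.
inv-* : ∀ p q → inv (p * q) ≡ inv p * inv q
inv-* p q = by-cases (p ≟ 0ℚ) (q ≟ 0ℚ)
  where
  by-cases : Dec (p ≡ 0ℚ) → Dec (q ≡ 0ℚ) → inv (p * q) ≡ inv p * inv q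
  by-cases (yes refl) _ = trans (cong inv (ℚₚ.*-zeroˡ q)) (sym (ℚₚ.*-zeroˡ (inv q)))
  by-cases (no _) (yes refl) = trans (cong inv (ℚₚ.*-zeroʳ p)) (sym (ℚₚ.*-zeroʳ (inv p)))
  by-cases (no p≢0) (no q≢0) = inv-unique (p * q) (begin
    p * q * (inv p * inv q)      ≡⟨ solve 4 (λ a b i j → a :* b :* (i :* j) := (a :* i) :* (b :* j)) refl p q (inv p) (inv q) ⟩
    (p * inv p) * (q * inv q)    ≡⟨ cong₂ _*_ (inv-inverseʳ p≢0) (inv-inverseʳ q≢0) ⟩
    1ℚ                           ∎)

inv-ℕ→ℚ-injective : ∀ {m n} → inv (ℕ→ℚ m) ≡ inv (ℕ→ℚ n) → m ≡ n
inv-ℕ→ℚ-injective {m} {n} eq =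
  ℕ→ℚ-injective (trans (sym (inv-involutive (ℕ→ℚ m))) (trans (cong inv eq) (inv-involutive (ℕ→ℚ n))))

factorial≡! : ∀ n → factorial n ≡ n !
factorial≡! zero    = refl
factorial≡! (suc n) = cong (suc n ℕ.*_) (factorial≡! n)

binomial*factorials≡factorial : ∀ {n k} → k ≤ n → (n C k) ℕ.* (factorial k ℕ.* factorial (n ∸ k)) ≡ factorial n
binomial*factorials≡factorial {n} {k} k≤n
  rewrite factorial≡! k | factorial≡! (n ∸ k) | factorial≡! n | nCk≡n!/k![n-k]! k≤n =
  trans (ℕₚ.*-comm _ (k ! ℕ.* (n ∸ k) !)) (m*[n/m]≡n {{ℕₚ._!*_!≢0 k (n ∸ k)}} (k![n∸k]!∣n! k≤n))

factorialℚ : ℕ → ℚ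
factorialℚ n = ℕ→ℚ (factorial n)

factorialℚ-suc : ∀ n → factorialℚ (suc n) ≡ ℕ→ℚ (suc n) * factorialℚ n
factorialℚ-suc n = ℕ→ℚ-* (suc n) (factorial n)

factorialℚ≢0 : ∀ n → factorialℚ n ≢ 0ℚ
factorialℚ≢0 n = ℕ→ℚ≢0 (subst (_≢ 0) (sym (factorial≡! n)) (ℕ.≢-nonZero⁻¹ (n !) {{n ℕₚ.!≢0}}))

factorialℚ-binomial : ∀ {n k} → k ≤ n → ℕ→ℚ (n C k) * (factorialℚ k * factorialℚ (n ∸ k)) ≡ factorialℚ n
factorialℚ-binomial {n} {k} k≤n = begin
  ℕ→ℚ (n C k) * (factorialℚ k * factorialℚ (n ∸ k))  ≡⟨ cong (ℕ→ℚ (n C k) *_) (ℕ→ℚ-* (factorial k) _) ⟨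
  ℕ→ℚ (n C k) * ℕ→ℚ (factorial k ℕ.* factorial (n ∸ k))  ≡⟨ ℕ→ℚ-* (n C k) _ ⟨
  ℕ→ℚ ((n C k) ℕ.* (factorial k ℕ.* factorial (n ∸ k)))  ≡⟨ cong ℕ→ℚ (binomial*factorials≡factorial k≤n) ⟩
  factorialℚ n                                          ∎

rising-1 : ∀ m → rising 1ℚ m ≡ factorialℚ m
rising-1 zero    = refl
rising-1 (suc m) = begin
  rising 1ℚ m * (1ℚ + ℕ→ℚ m)   ≡⟨ cong₂ _*_ (rising-1 m) (sym (ℕ→ℚ-suc m)) ⟩
  factorialℚ m * ℕ→ℚ (suc m)   ≡⟨ ℚₚ.*-comm (factorialℚ m) _ ⟩
  ℕ→ℚ (suc m) * factorialℚ m   ≡⟨ factorialℚ-suc m ⟨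
  factorialℚ (suc m)           ∎

data Parity : ℕ → Set where
  even : ∀ m → Parity (m ℕ.* 2)
  odd  : ∀ m → Parity (suc (m ℕ.* 2))

parity : ∀ n → Parity n
parity zero = even 0
parity (suc n) with parity n
... | even m = odd m
... | odd m  = even (suc m)

coshS-even : ∀ m → coshS (m ℕ.* 2) ≡ inv (factorialℚ (m ℕ.* 2))
coshS-even m with (m ℕ.* 2) % 2 | m*n%n≡0 m 2
... | _ | refl = refl

coshS-odd : ∀ m → coshS (suc (m ℕ.* 2)) ≡ 0ℚ
coshS-odd m with suc (m ℕ.* 2) % 2 | [m+kn]%n≡m%n 1 m 2
... | _ | refl = refl

substSqOver4-odd : ∀ f m → substSqOver4 f (suc (m ℕ.* 2)) ≡ 0ℚ
substSqOver4-odd f m with suc (m ℕ.* 2) % 2 | [m+kn]%n≡m%n 1 m 2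
... | _ | refl = refl

-- substSqOver4 computes 4^(n/2) with a copy of _^_ local to its where block, which cannot be
-- named here. Its agreement with _^_ is proved against the with-abstracted goal, whose type
-- Agda infers into LocalPower≡^; the instance v = 1ℚ of the hypothesis recovers the exponent
-- equation because inv ∘ ℕ→ℚ is injective.
mutual
  LocalPower≡^ : FPS → ℕ → ℚ → ℕ → ℕ → Set
  LocalPower≡^ = _

  substSqOver4-%2≡0 : ∀ f n → n % 2 ≡ 0 → substSqOver4 f n ≡ f (n / 2) * inv (ℕ→ℚ (4 ^ (n / 2)))
  substSqOver4-%2≡0 f n n%2≡0 with n % 2 | n%2≡0
  ... | _ | refl with n / 2 | 4 | f (n / 2)
  ... | h | b | v = localPower≡^ f n v b h

  localPower≡^ : ∀ f n v b h → LocalPower≡^ f n v b h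
  localPower≡^ f n v b zero    = refl
  localPower≡^ f n v b (suc h) = cong (λ p → v * inv (ℕ→ℚ (b ℕ.* p))) (inv-ℕ→ℚ-injective
    (trans (sym (ℚₚ.*-identityˡ _)) (trans (localPower≡^ f n 1ℚ b h) (ℚₚ.*-identityˡ _))))

substSqOver4-even : ∀ f m → substSqOver4 f (m ℕ.* 2) ≡ f m * inv (ℕ→ℚ (4 ^ m))
substSqOver4-even f m = trans (substSqOver4-%2≡0 f (m ℕ.* 2) (m*n%n≡0 m 2))
  (cong (λ h → f h * inv (ℕ→ℚ (4 ^ h))) (m*n/n≡m m 2))

rising-product : ∀ k (b c : ℚ) →
  (∀ j → (b + ℕ→ℚ j) * (c + ℕ→ℚ j) * ℕ→ℚ 4 ≡ ℕ→ℚ (2 ℕ.+ (j ℕ.* 2 ℕ.+ k)) * ℕ→ℚ (1 ℕ.+ (j ℕ.* 2 ℕ.+ k))) →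
  ∀ m → factorialℚ k * (rising b m * rising c m * ℕ→ℚ (4 ^ m)) ≡ factorialℚ (m ℕ.* 2 ℕ.+ k)
rising-product k b c step zero    = ℚₚ.*-identityʳ (factorialℚ k)
rising-product k b c step (suc m) = begin
  factorialℚ k * (rising b m * (b + M) * (rising c m * (c + M)) * ℕ→ℚ (4 ℕ.* 4 ^ m))
    ≡⟨ cong (λ p → factorialℚ k * (rising b m * (b + M) * (rising c m * (c + M)) * p)) (ℕ→ℚ-* 4 (4 ^ m)) ⟩
  factorialℚ k * (rising b m * (b + M) * (rising c m * (c + M)) * (ℕ→ℚ 4 * ℕ→ℚ (4 ^ m)))
    ≡⟨ solve 7 (λ a rb rc p bm cm f → a :* (rb :* bm :* (rc :* cm) :* (f :* p)) := (a :* (rb :* rc :* p)) :* (bm :* cm :* f))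
         refl (factorialℚ k) (rising b m) (rising c m) (ℕ→ℚ (4 ^ m)) (b + M) (c + M) (ℕ→ℚ 4) ⟩
  factorialℚ k * (rising b m * rising c m * ℕ→ℚ (4 ^ m)) * ((b + M) * (c + M) * ℕ→ℚ 4)
    ≡⟨ cong₂ _*_ (rising-product k b c step m) (step m) ⟩
  factorialℚ y * (ℕ→ℚ (2 ℕ.+ y) * ℕ→ℚ (1 ℕ.+ y))
    ≡⟨ solve 3 (λ f a b → f :* (a :* b) := a :* (b :* f)) refl (factorialℚ y) (ℕ→ℚ (2 ℕ.+ y)) (ℕ→ℚ (1 ℕ.+ y)) ⟩
  ℕ→ℚ (2 ℕ.+ y) * (ℕ→ℚ (1 ℕ.+ y) * factorialℚ y)
    ≡⟨ cong (ℕ→ℚ (2 ℕ.+ y) *_) (factorialℚ-suc y) ⟨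
  ℕ→ℚ (2 ℕ.+ y) * factorialℚ (1 ℕ.+ y)
    ≡⟨ factorialℚ-suc (suc y) ⟨
  factorialℚ (2 ℕ.+ y)  ∎
  where
  M : ℚ
  M = ℕ→ℚ m
  y : ℕ
  y = m ℕ.* 2 ℕ.+ k

/2-double : ∀ m → (m ℕ.* 2) / 2 ≡ m
/2-double m = m*n/n≡m m 2

/2-double+1 : ∀ m → suc (m ℕ.* 2) / 2 ≡ m
/2-double+1 m = trans (+-distrib-/-∣ʳ 1 {d = 2} (divides-refl m)) (/2-double m)

floors-product : ∀ k j → ((k ℕ.+ 2) / 2 ℕ.+ j) ℕ.* 2 ℕ.* suc (((k ℕ.+ 1) / 2 ℕ.+ j) ℕ.* 2)
                         ≡ (2 ℕ.+ (j ℕ.* 2 ℕ.+ k)) ℕ.* (1 ℕ.+ (j ℕ.* 2 ℕ.+ k))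
floors-product k j with parity k
... | even K
  rewrite ℕₚ.+-comm (K ℕ.* 2) 2 | ℕₚ.+-comm (K ℕ.* 2) 1 | /2-double (suc K) | /2-double+1 K =
  ℕ-Tactic.solve (K ∷ j ∷ [])
... | odd K
  rewrite ℕₚ.+-comm (K ℕ.* 2) 2 | ℕₚ.+-comm (K ℕ.* 2) 1 | /2-double (suc K) | /2-double+1 (suc K) =
  ℕ-Tactic.solve (K ∷ j ∷ [])

half-integer-product : ∀ b c j →
  (ℕ→ℚ b + ℕ→ℚ j) * (ℕ→ℚ c + ½ + ℕ→ℚ j) * ℕ→ℚ 4 ≡ ℕ→ℚ ((b ℕ.+ j) ℕ.* 2 ℕ.* suc ((c ℕ.+ j) ℕ.* 2))
half-integer-product b c j = sym (begin
  ℕ→ℚ ((b ℕ.+ j) ℕ.* 2 ℕ.* suc ((c ℕ.+ j) ℕ.* 2))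
    ≡⟨ ℕ→ℚ-* ((b ℕ.+ j) ℕ.* 2) (suc ((c ℕ.+ j) ℕ.* 2)) ⟩
  ℕ→ℚ ((b ℕ.+ j) ℕ.* 2) * ℕ→ℚ (suc ((c ℕ.+ j) ℕ.* 2))
    ≡⟨ cong₂ _*_ (twice b) (trans (ℕ→ℚ-suc ((c ℕ.+ j) ℕ.* 2)) (cong (1ℚ +_) (twice c))) ⟩
  (ℕ→ℚ b + ℕ→ℚ j) * ℕ→ℚ 2 * (1ℚ + (ℕ→ℚ c + ℕ→ℚ j) * ℕ→ℚ 2)
    ≡⟨ solve 3 (λ b c j → (b :+ j) :* con (ℕ→ℚ 2) :* (con 1ℚ :+ (c :+ j) :* con (ℕ→ℚ 2))
                          := (b :+ j) :* (c :+ con ½ :+ j) :* con (ℕ→ℚ 4)) refl (ℕ→ℚ b) (ℕ→ℚ c) (ℕ→ℚ j) ⟩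
  (ℕ→ℚ b + ℕ→ℚ j) * (ℕ→ℚ c + ½ + ℕ→ℚ j) * ℕ→ℚ 4  ∎)
  where
  twice : ∀ a → ℕ→ℚ ((a ℕ.+ j) ℕ.* 2) ≡ (ℕ→ℚ a + ℕ→ℚ j) * ℕ→ℚ 2
  twice a = trans (ℕ→ℚ-* (a ℕ.+ j) 2) (cong (_* ℕ→ℚ 2) (ℕ→ℚ-+ a j))

F-parameters-step : ∀ k j →
  (ℕ→ℚ ((k ℕ.+ 2) / 2) + ℕ→ℚ j) * (ℕ→ℚ ((k ℕ.+ 1) / 2) + ½ + ℕ→ℚ j) * ℕ→ℚ 4
    ≡ ℕ→ℚ (2 ℕ.+ (j ℕ.* 2 ℕ.+ k)) * ℕ→ℚ (1 ℕ.+ (j ℕ.* 2 ℕ.+ k))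
F-parameters-step k j = begin
  (ℕ→ℚ ((k ℕ.+ 2) / 2) + ℕ→ℚ j) * (ℕ→ℚ ((k ℕ.+ 1) / 2) + ½ + ℕ→ℚ j) * ℕ→ℚ 4
    ≡⟨ half-integer-product ((k ℕ.+ 2) / 2) ((k ℕ.+ 1) / 2) j ⟩
  ℕ→ℚ (((k ℕ.+ 2) / 2 ℕ.+ j) ℕ.* 2 ℕ.* suc (((k ℕ.+ 1) / 2 ℕ.+ j) ℕ.* 2))
    ≡⟨ cong ℕ→ℚ (floors-product k j) ⟩
  ℕ→ℚ ((2 ℕ.+ (j ℕ.* 2 ℕ.+ k)) ℕ.* (1 ℕ.+ (j ℕ.* 2 ℕ.+ k)))
    ≡⟨ ℕ→ℚ-* (2 ℕ.+ (j ℕ.* 2 ℕ.+ k)) (1 ℕ.+ (j ℕ.* 2 ℕ.+ k)) ⟩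
  ℕ→ℚ (2 ℕ.+ (j ℕ.* 2 ℕ.+ k)) * ℕ→ℚ (1 ℕ.+ (j ℕ.* 2 ℕ.+ k))  ∎

F-even : ∀ k m → F k (m ℕ.* 2) ≡ factorialℚ k * inv (factorialℚ (m ℕ.* 2 ℕ.+ k))
F-even k m = begin
  F k (m ℕ.* 2)
    ≡⟨ substSqOver4-even _ m ⟩
  rising 1ℚ m * inv (Q * factorialℚ m) * inv P
    ≡⟨ cong₂ (λ x y → x * y * inv P) (rising-1 m) (inv-* Q (factorialℚ m)) ⟩
  factorialℚ m * (inv Q * inv (factorialℚ m)) * inv P
    ≡⟨ solve 4 (λ f q i p → f :* (q :* i) :* p := (f :* i) :* (q :* p)) refl (factorialℚ m) (inv Q) (inv (factorialℚ m)) (inv P) ⟩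
  (factorialℚ m * inv (factorialℚ m)) * (inv Q * inv P)
    ≡⟨ cong₂ _*_ (inv-inverseʳ (factorialℚ≢0 m)) (sym (inv-* Q P)) ⟩
  1ℚ * inv (Q * P)
    ≡⟨ cong (_* inv (Q * P)) (inv-inverseʳ (factorialℚ≢0 k)) ⟨
  factorialℚ k * inv (factorialℚ k) * inv (Q * P)
    ≡⟨ ℚₚ.*-assoc (factorialℚ k) _ _ ⟩
  factorialℚ k * (inv (factorialℚ k) * inv (Q * P))
    ≡⟨ cong (factorialℚ k *_) (inv-* (factorialℚ k) (Q * P)) ⟨
  factorialℚ k * inv (factorialℚ k * (Q * P))
    ≡⟨ cong (λ x → factorialℚ k * inv x) (rising-product k _ _ (F-parameters-step k) m) ⟩
  factorialℚ k * inv (factorialℚ (m ℕ.* 2 ℕ.+ k))  ∎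
  where
  Q P : ℚ
  Q = rising (ℕ→ℚ ((k ℕ.+ 2) / 2)) m * rising (ℕ→ℚ ((k ℕ.+ 1) / 2) + ½) m
  P = ℕ→ℚ (4 ^ m)

F-odd : ∀ k m → F k (suc (m ℕ.* 2)) ≡ 0ℚ
F-odd k = substSqOver4-odd _

derivIter-coefficient : ∀ i f m → derivIter i f m ≡ factorialℚ (m ℕ.+ i) * inv (factorialℚ m) * f (m ℕ.+ i)
derivIter-coefficient zero f m rewrite ℕₚ.+-identityʳ m = begin
  f m                                      ≡⟨ ℚₚ.*-identityˡ (f m) ⟨
  1ℚ * f m                                 ≡⟨ cong (_* f m) (inv-inverseʳ (factorialℚ≢0 m)) ⟨
  factorialℚ m * inv (factorialℚ m) * f m  ∎
derivIter-coefficient (suc i) f m = begin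
  s * derivIter i f (suc m)                   ≡⟨ cong (s *_) (derivIter-coefficient i f (suc m)) ⟩
  s * (g * inv (factorialℚ (suc m)) * y)      ≡⟨ cong (λ x → s * (g * inv x * y)) (factorialℚ-suc m) ⟩
  s * (g * inv (s * m!) * y)                  ≡⟨ cong (λ x → s * (g * x * y)) (inv-* s m!) ⟩
  s * (g * (inv s * inv m!) * y)              ≡⟨ solve 5 (λ s g j h y → s :* (g :* (j :* h) :* y) := (s :* j) :* (g :* h :* y))
                                                   refl s g (inv s) (inv m!) y ⟩
  (s * inv s) * (g * inv m! * y)              ≡⟨ cong (_* (g * inv m! * y)) (inv-inverseʳ (ℕ→ℚ≢0 {suc m} λ ())) ⟩
  1ℚ * (g * inv m! * y)                       ≡⟨ ℚₚ.*-identityˡ (g * inv m! * y) ⟩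
  g * inv m! * y                              ≡⟨ cong (λ n → factorialℚ n * inv m! * f n) (ℕₚ.+-suc m i) ⟨
  factorialℚ (m ℕ.+ suc i) * inv m! * f (m ℕ.+ suc i)  ∎
  where
  s g y m! : ℚ
  s  = ℕ→ℚ (suc m)
  g  = factorialℚ (suc m ℕ.+ i)
  y  = f (suc m ℕ.+ i)
  m! = factorialℚ m

taylor-coefficient : ∀ i f n → inv (factorialℚ i) * mulT^ i (derivIter i f) n ≡ ℕ→ℚ (n C i) * f n
taylor-coefficient i f n with i ≤? n
... | no i≰n = begin
  inv (factorialℚ i) * 0ℚ   ≡⟨ ℚₚ.*-zeroʳ (inv (factorialℚ i)) ⟩
  0ℚ                        ≡⟨ ℚₚ.*-zeroˡ (f n) ⟨
  ℕ→ℚ 0 * f n               ≡⟨ cong (λ c → ℕ→ℚ c * f n) (k>n⇒nCk≡0 (ℕₚ.≰⇒> i≰n)) ⟨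
  ℕ→ℚ (n C i) * f n         ∎
... | yes i≤n = begin
  inv i! * derivIter i f (n ∸ i)
    ≡⟨ cong (inv i! *_) (derivIter-coefficient i f (n ∸ i)) ⟩
  inv i! * (factorialℚ (n ∸ i ℕ.+ i) * inv [n∸i]! * f (n ∸ i ℕ.+ i))
    ≡⟨ cong (λ m → inv i! * (factorialℚ m * inv [n∸i]! * f m)) (ℕₚ.m∸n+n≡m i≤n) ⟩
  inv i! * (factorialℚ n * inv [n∸i]! * f n)
    ≡⟨ cong (λ x → inv i! * (x * inv [n∸i]! * f n)) (factorialℚ-binomial i≤n) ⟨
  inv i! * (ℕ→ℚ (n C i) * (i! * [n∸i]!) * inv [n∸i]! * f n)
    ≡⟨ solve 6 (λ a c b d e y → a :* (c :* (b :* d) :* e :* y) := c :* (b :* a) :* (d :* e) :* y)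
         refl (inv i!) (ℕ→ℚ (n C i)) i! [n∸i]! (inv [n∸i]!) (f n) ⟩
  ℕ→ℚ (n C i) * (i! * inv i!) * ([n∸i]! * inv [n∸i]!) * f n
    ≡⟨ cong₂ (λ x y → ℕ→ℚ (n C i) * x * y * f n) (inv-inverseʳ (factorialℚ≢0 i)) (inv-inverseʳ (factorialℚ≢0 (n ∸ i))) ⟩
  ℕ→ℚ (n C i) * 1ℚ * 1ℚ * f n
    ≡⟨ cong (_* f n) (trans (ℚₚ.*-identityʳ (ℕ→ℚ (n C i) * 1ℚ)) (ℚₚ.*-identityʳ (ℕ→ℚ (n C i)))) ⟩
  ℕ→ℚ (n C i) * f n  ∎
  where
  i! [n∸i]! : ℚ
  i!     = factorialℚ i
  [n∸i]! = factorialℚ (n ∸ i)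

sumUpTo : ℕ → (ℕ → ℕ) → ℕ
sumUpTo zero    a = a 0
sumUpTo (suc j) a = sumUpTo j a ℕ.+ a (suc j)

sumUpTo-cong : ∀ j {a b : ℕ → ℕ} → (∀ i → a i ≡ b i) → sumUpTo j a ≡ sumUpTo j b
sumUpTo-cong zero    a≗b = a≗b 0
sumUpTo-cong (suc j) a≗b = cong₂ ℕ._+_ (sumUpTo-cong j a≗b) (a≗b (suc j))

sumUpTo-+ : ∀ j (a b : ℕ → ℕ) → sumUpTo j (λ i → a i ℕ.+ b i) ≡ sumUpTo j a ℕ.+ sumUpTo j b
sumUpTo-+ zero    a b = refl
sumUpTo-+ (suc j) a b = begin
  sumUpTo j (λ i → a i ℕ.+ b i) ℕ.+ (a (suc j) ℕ.+ b (suc j))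
    ≡⟨ cong (ℕ._+ (a (suc j) ℕ.+ b (suc j))) (sumUpTo-+ j a b) ⟩
  sumUpTo j a ℕ.+ sumUpTo j b ℕ.+ (a (suc j) ℕ.+ b (suc j))
    ≡⟨ +-interchange (sumUpTo j a) (sumUpTo j b) (a (suc j)) (b (suc j)) ⟩
  sumUpTo j a ℕ.+ a (suc j) ℕ.+ (sumUpTo j b ℕ.+ b (suc j))  ∎

sumUpTo-shift : ∀ j a → sumUpTo (suc j) a ≡ a 0 ℕ.+ sumUpTo j (λ i → a (suc i))
sumUpTo-shift zero    a = refl
sumUpTo-shift (suc j) a =
  trans (cong (ℕ._+ a (suc (suc j))) (sumUpTo-shift j a)) (ℕₚ.+-assoc (a 0) _ (a (suc (suc j))))

sumUpTo-last≡0 : ∀ j a → a (suc j) ≡ 0 → sumUpTo (suc j) a ≡ sumUpTo j a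
sumUpTo-last≡0 j a last≡0 = trans (cong (sumUpTo j a ℕ.+_) last≡0) (ℕₚ.+-identityʳ (sumUpTo j a))

vandermonde : ∀ K n j → sumUpTo K (λ i → (K C i) ℕ.* (n C (i ℕ.+ j))) ≡ (n ℕ.+ K) C (K ℕ.+ j)
vandermonde zero    n j rewrite ℕₚ.+-identityʳ n = ℕₚ.+-identityʳ (n C j)
vandermonde (suc K) n j = begin
  sumUpTo (suc K) (λ i → (suc K C i) ℕ.* (n C (i ℕ.+ j)))
    ≡⟨ sumUpTo-shift K _ ⟩
  n C j ℕ.+ 0 ℕ.+ sumUpTo K (λ i → (suc K C suc i) ℕ.* (n C suc (i ℕ.+ j)))
    ≡⟨ cong (n C j ℕ.+ 0 ℕ.+_) (trans (sumUpTo-cong K pascal) (sumUpTo-+ K _ _)) ⟩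
  n C j ℕ.+ 0 ℕ.+ (A ℕ.+ B)
    ≡⟨ x+[y+z]≡y+[x+z] (n C j ℕ.+ 0) A B ⟩
  A ℕ.+ (n C j ℕ.+ 0 ℕ.+ B)
    ≡⟨ cong₂ ℕ._+_ A≡ B≡ ⟩
  (n ℕ.+ K) C suc (K ℕ.+ j) ℕ.+ (n ℕ.+ K) C (K ℕ.+ j)
    ≡⟨ ℕₚ.+-comm ((n ℕ.+ K) C suc (K ℕ.+ j)) _ ⟩
  (n ℕ.+ K) C (K ℕ.+ j) ℕ.+ (n ℕ.+ K) C suc (K ℕ.+ j)
    ≡⟨ nCk+nC[k+1]≡[n+1]C[k+1] (n ℕ.+ K) (K ℕ.+ j) ⟩
  suc (n ℕ.+ K) C suc (K ℕ.+ j)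
    ≡⟨ cong (_C suc (K ℕ.+ j)) (ℕₚ.+-suc n K) ⟨
  (n ℕ.+ suc K) C (suc K ℕ.+ j)  ∎
  where
  A B : ℕ
  A = sumUpTo K (λ i → (K C i) ℕ.* (n C suc (i ℕ.+ j)))
  B = sumUpTo K (λ i → (K C suc i) ℕ.* (n C suc (i ℕ.+ j)))
  pascal : ∀ i → (suc K C suc i) ℕ.* (n C suc (i ℕ.+ j))
               ≡ (K C i) ℕ.* (n C suc (i ℕ.+ j)) ℕ.+ (K C suc i) ℕ.* (n C suc (i ℕ.+ j))
  pascal i = trans (cong (ℕ._* (n C suc (i ℕ.+ j))) (sym (nCk+nC[k+1]≡[n+1]C[k+1] K i)))
                   (ℕₚ.*-distribʳ-+ (n C suc (i ℕ.+ j)) (K C i) (K C suc i))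
  A≡ : A ≡ (n ℕ.+ K) C suc (K ℕ.+ j)
  A≡ = begin
    A                                                  ≡⟨ sumUpTo-cong K (λ i → cong (λ m → (K C i) ℕ.* (n C m)) (ℕₚ.+-suc i j)) ⟨
    sumUpTo K (λ i → (K C i) ℕ.* (n C (i ℕ.+ suc j)))  ≡⟨ vandermonde K n (suc j) ⟩
    (n ℕ.+ K) C (K ℕ.+ suc j)                          ≡⟨ cong ((n ℕ.+ K) C_) (ℕₚ.+-suc K j) ⟩
    (n ℕ.+ K) C suc (K ℕ.+ j)                          ∎
  B≡ : n C j ℕ.+ 0 ℕ.+ B ≡ (n ℕ.+ K) C (K ℕ.+ j)
  B≡ = begin
    n C j ℕ.+ 0 ℕ.+ B                                      ≡⟨ sumUpTo-shift K (λ i → (K C i) ℕ.* (n C (i ℕ.+ j))) ⟨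
    sumUpTo (suc K) (λ i → (K C i) ℕ.* (n C (i ℕ.+ j)))    ≡⟨ sumUpTo-last≡0 K _ (cong (ℕ._* (n C suc (K ℕ.+ j))) (k>n⇒nCk≡0 (ℕₚ.n<1+n K))) ⟩
    sumUpTo K (λ i → (K C i) ℕ.* (n C (i ℕ.+ j)))          ≡⟨ vandermonde K n j ⟩
    (n ℕ.+ K) C (K ℕ.+ j)                                  ∎

sumTo-coefficient : ∀ (g : ℕ → FPS) (a : ℕ → ℕ) {n x} →
  (∀ i → g i n ≡ ℕ→ℚ (a i) * x) → ∀ j → sumTo j g n ≡ ℕ→ℚ (sumUpTo j a) * x
sumTo-coefficient g a coef zero = coef 0
sumTo-coefficient g a {n} {x} coef (suc j) = begin
  sumTo j g n + g (suc j) n                          ≡⟨ cong₂ _+_ (sumTo-coefficient g a coef j) (coef (suc j)) ⟩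
  ℕ→ℚ (sumUpTo j a) * x + ℕ→ℚ (a (suc j)) * x        ≡⟨ ℚₚ.*-distribʳ-+ x (ℕ→ℚ (sumUpTo j a)) (ℕ→ℚ (a (suc j))) ⟨
  (ℕ→ℚ (sumUpTo j a) + ℕ→ℚ (a (suc j))) * x          ≡⟨ cong (_* x) (ℕ→ℚ-+ (sumUpTo j a) (a (suc j))) ⟨
  ℕ→ℚ (sumUpTo (suc j) a) * x                        ∎

rhs-coefficient : ∀ k n → rhs k n ≡ ℕ→ℚ ((n ℕ.+ k) C k) * F k n
rhs-coefficient k n = begin
  rhs k n                                                   ≡⟨ sumTo-coefficient _ (λ i → (k C i) ℕ.* (n C i)) term k ⟩
  ℕ→ℚ (sumUpTo k (λ i → (k C i) ℕ.* (n C i))) * F k n      ≡⟨ cong (λ s → ℕ→ℚ s * F k n) diagonal ⟩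
  ℕ→ℚ ((n ℕ.+ k) C k) * F k n                               ∎
  where
  term : ∀ i → inv (factorialℚ i) * ℕ→ℚ (k C i) * mulT^ i (derivIter i (F k)) n ≡ ℕ→ℚ ((k C i) ℕ.* (n C i)) * F k n
  term i = begin
    inv (factorialℚ i) * ℕ→ℚ (k C i) * mulT^ i (derivIter i (F k)) n
      ≡⟨ solve 3 (λ a c t → a :* c :* t := c :* (a :* t)) refl (inv (factorialℚ i)) (ℕ→ℚ (k C i)) (mulT^ i (derivIter i (F k)) n) ⟩
    ℕ→ℚ (k C i) * (inv (factorialℚ i) * mulT^ i (derivIter i (F k)) n)
      ≡⟨ cong (ℕ→ℚ (k C i) *_) (taylor-coefficient i (F k) n) ⟩
    ℕ→ℚ (k C i) * (ℕ→ℚ (n C i) * F k n)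
      ≡⟨ ℚₚ.*-assoc (ℕ→ℚ (k C i)) (ℕ→ℚ (n C i)) (F k n) ⟨
    ℕ→ℚ (k C i) * ℕ→ℚ (n C i) * F k n
      ≡⟨ cong (_* F k n) (ℕ→ℚ-* (k C i) (n C i)) ⟨
    ℕ→ℚ ((k C i) ℕ.* (n C i)) * F k n  ∎
  diagonal : sumUpTo k (λ i → (k C i) ℕ.* (n C i)) ≡ (n ℕ.+ k) C k
  diagonal = begin
    sumUpTo k (λ i → (k C i) ℕ.* (n C i))          ≡⟨ sumUpTo-cong k (λ i → cong (λ m → (k C i) ℕ.* (n C m)) (ℕₚ.+-identityʳ i)) ⟨
    sumUpTo k (λ i → (k C i) ℕ.* (n C (i ℕ.+ 0)))  ≡⟨ vandermonde k n 0 ⟩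
    (n ℕ.+ k) C (k ℕ.+ 0)                          ≡⟨ cong ((n ℕ.+ k) C_) (ℕₚ.+-identityʳ k) ⟩
    (n ℕ.+ k) C k                                  ∎

cosh-coefficient : ∀ k n → coshS n ≡ ℕ→ℚ ((n ℕ.+ k) C k) * F k n
cosh-coefficient k n with parity n
... | odd m = begin
  coshS (suc (m ℕ.* 2))                ≡⟨ coshS-odd m ⟩
  0ℚ                                   ≡⟨ ℚₚ.*-zeroʳ c ⟨
  c * 0ℚ                               ≡⟨ cong (c *_) (F-odd k m) ⟨
  c * F k (suc (m ℕ.* 2))              ∎
  where
  c : ℚ
  c = ℕ→ℚ ((n ℕ.+ k) C k)
... | even m = trans (coshS-even m) (inv-unique n! (begin
  n! * (c * F k (m ℕ.* 2))                     ≡⟨ cong (λ x → n! * (c * x)) (F-even k m) ⟩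
  n! * (c * (k! * inv (factorialℚ (n ℕ.+ k))))  ≡⟨ solve 4 (λ a b d e → a :* (b :* (d :* e)) := b :* (d :* a) :* e) refl n! c k! (inv (factorialℚ (n ℕ.+ k))) ⟩
  c * (k! * n!) * inv (factorialℚ (n ℕ.+ k))    ≡⟨ cong (_* inv (factorialℚ (n ℕ.+ k))) binomial ⟩
  factorialℚ (n ℕ.+ k) * inv (factorialℚ (n ℕ.+ k))  ≡⟨ inv-inverseʳ (factorialℚ≢0 (n ℕ.+ k)) ⟩
  1ℚ                                           ∎))
  where
  c n! k! : ℚ
  c  = ℕ→ℚ ((n ℕ.+ k) C k)
  n! = factorialℚ n
  k! = factorialℚ k
  binomial : c * (k! * n!) ≡ factorialℚ (n ℕ.+ k)
  binomial = trans (cong (λ d → c * (k! * factorialℚ d)) (sym (ℕₚ.m+n∸n≡m n k))) (factorialℚ-binomial (ℕₚ.m≤n+m k n))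

proposition4 : (N k : ℕ) → k ≤ 2 ℕ.* N → coshS ≈ₛ rhs k
proposition4 _ k _ n = trans (cosh-coefficient k n) (sym (rhs-coefficient k n))
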